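{- If $\Gamma$ is a $\square$-prelinear theory of $\mathrm{S5}(\mathcal L)_\infty$, then the Lindenbaum algebra $\mathbf L_\Gamma$ is a simple monadic MV-algebra.
   Context: Let $Fm$ be the set of formulas over a countably infinite set of variables with $\wedge,\vee,*,\rightarrow,\bar0$ and unary $\square,\lozenge$; $\bar1:=\bar0\rightarrow\bar0$, $\alpha\equiv\beta:=(\alpha\rightarrow\beta)\wedge(\beta\rightarrow\alpha)$, $\psi^n$ the $n$-fold $*$-power. $\mathrm{S5}(\mathcal L)$ is the calculus with the following axioms: - all instances of the axiom schemata of Łukasiewicz propositional logic; - $\square\varphi\rightarrow\varphi$; - $\varphi\rightarrow\lozenge\varphi$; - $\square(\nu\rightarrow\varphi)\rightarrow(\nu\rightarrow\square\varphi)$; - $\square(\varphi\rightarrow\nu)\rightarrow(\lozenge\varphi\rightarrow\nu)$; - $\square(\varphi\vee\nu)\rightarrow(\square\varphi\vee\nu)$; - $\lozenge(\varphi*\varphi)\equiv(\lozenge\varphi)*(\lozenge\varphi)$. Here $\nu$ is any propositional combination of formulas beginning with $\square$ or $\lozenge$. Its rules are Modus Ponens and Necessitation. $\mathrm{S5}(\mathcal L)_\infty$ adds the rule $\square$Inf: from $\square\varphi\vee(\square\alpha\rightarrow(\square\beta)^n)$ for all $n\in\mathbb N$, infer $\square\varphi\vee(\square\alpha\rightarrow\square\alpha*\square\beta)$. Derivations from $\Gamma$ may be transfinite (well-ordered) and are written $\Gamma\vdash\varphi$. A theory is a set $\Gamma$ closed under $\vdash$; it is $\square$-prelinear if for all $\alpha,\beta$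 one of $\square\alpha\rightarrow\square\beta$, $\square\beta\rightarrow\square\alpha$ belongs to $\Gamma$. $\varphi\equiv_\Gamma\psi$ iff $\Gamma\vdash\varphi\rightarrow\psi$ and $\Gamma\vdash\psi\rightarrow\varphi$. $\mathbf L_\Gamma$ is $Fm/{\equiv_\Gamma}$ with the following operations: - $0=[\bar0]$ and $1=[\bar1]$; - $[\varphi]\star[\psi]=[\varphi\star\psi]$ for $\star\in\{\wedge,\vee,*,\rightarrow\}$; - $\forall[\varphi]=[\square\varphi]$ and $\exists[\varphi]=[\lozenge\varphi]$. A monadic MV-algebra is an MV-algebra with unary $\exists,\forall$ satisfying: - $\forall x\rightarrow x\approx1$; - $\forall(x\rightarrow\forall y)\approx\exists x\rightarrow\forall y$; - $\forall(\forall x\rightarrow y)\approx\forall x\rightarrow\forall y$; - $\forall(\exists x\vee y)\approx\exists x\vee\forall y$; - $\exists(x*x)\approx\exists x*\exists x$. It is simple if it has exactly two congruences. -}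

module Defs where

open import Data.Nat using (ℕ; zero; suc)
open import Data.Product using (_×_; Σ; ∃; _,_)
open import Data.Sum using (_⊎_)
open import Relation.Nullary using (¬_)
open import Relation.Binary.Structures using (IsEquivalence)

infixr 4 _⇒_
infixr 5 _∨_
infixr 6 _∧_
infixr 7 _&_

-- Formulas: variables (ℕ), ∧, ∨, * (written &), →, 0̄, □, ◇

data Fm : Set where
  var : ℕ → Fm
  _∧_ _∨_ _&_ _⇒_ : Fm → Fm → Fm
  𝟘 : Fm
  □ ◇ : Fm → Fm

𝟙 : Fm
𝟙 = 𝟘 ⇒ 𝟘

_≣_ : Fm → Fm → Fm
α ≣ β = (α ⇒ β) ∧ (β ⇒ α)

_^_ : Fm → ℕ → Fm
ψ ^ zero = 𝟙
ψ ^ suc n = (ψ ^ n) & ψ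

data IsNu : Fm → Set where
  nu□ : ∀ φ → IsNu (□ φ)
  nu◇ : ∀ φ → IsNu (◇ φ)
  nu𝟘 : IsNu 𝟘
  nu∧ : ∀ {a b} → IsNu a → IsNu b → IsNu (a ∧ b)
  nu∨ : ∀ {a b} → IsNu a → IsNu b → IsNu (a ∨ b)
  nu& : ∀ {a b} → IsNu a → IsNu b → IsNu (a & b)
  nu⇒ : ∀ {a b} → IsNu a → IsNu b → IsNu (a ⇒ b)

-- Axioms of S5(Ł)
-- Łukasiewicz logic: Hájek's BL axioms (with ∧, ∨ primitive, as in MTL/BL
-- presentations) plus the involution axiom ¬¬φ → φ.

data Axiom : Fm → Set where
  L1  : ∀ φ ψ χ → Axiom ((φ ⇒ ψ) ⇒ ((ψ ⇒ χ) ⇒ (φ ⇒ χ)))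
  L2  : ∀ φ ψ → Axiom ((φ & ψ) ⇒ φ)
  L3  : ∀ φ ψ → Axiom ((φ & ψ) ⇒ (ψ & φ))
  L4  : ∀ φ ψ → Axiom ((φ ∧ ψ) ⇒ φ)
  L5  : ∀ φ ψ → Axiom ((φ ∧ ψ) ⇒ (ψ ∧ φ))
  L6a : ∀ φ ψ → Axiom ((φ & (φ ⇒ ψ)) ⇒ (φ ∧ ψ))
  L6b : ∀ φ ψ → Axiom ((φ ∧ ψ) ⇒ (φ & (φ ⇒ ψ)))
  L7a : ∀ φ ψ χ → Axiom ((φ ⇒ (ψ ⇒ χ)) ⇒ ((φ & ψ) ⇒ χ))
  L7b : ∀ φ ψ χ → Axiom (((φ & ψ) ⇒ χ) ⇒ (φ ⇒ (ψ ⇒ χ)))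
  L8  : ∀ φ ψ χ → Axiom (((φ ⇒ ψ) ⇒ χ) ⇒ (((ψ ⇒ φ) ⇒ χ) ⇒ χ))
  L9  : ∀ φ → Axiom (𝟘 ⇒ φ)
  L10 : ∀ φ ψ → Axiom (φ ⇒ (φ ∨ ψ))
  L11 : ∀ φ ψ → Axiom (ψ ⇒ (φ ∨ ψ))
  L12 : ∀ φ ψ χ → Axiom ((φ ⇒ χ) ⇒ ((ψ ⇒ χ) ⇒ ((φ ∨ ψ) ⇒ χ)))
  L13 : ∀ φ → Axiom (((φ ⇒ 𝟘) ⇒ 𝟘) ⇒ φ)
  M1 : ∀ φ → Axiom (□ φ ⇒ φ)
  M2 : ∀ φ → Axiom (φ ⇒ ◇ φ)
  M3 : ∀ ν φ → IsNu ν → Axiom (□ (ν ⇒ φ) ⇒ (ν ⇒ □ φ))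
  M4 : ∀ ν φ → IsNu ν → Axiom (□ (φ ⇒ ν) ⇒ (◇ φ ⇒ ν))
  M5 : ∀ ν φ → IsNu ν → Axiom (□ (φ ∨ ν) ⇒ (□ φ ∨ ν))
  M6 : ∀ φ → Axiom (◇ (φ & φ) ≣ (◇ φ & ◇ φ))

-- Derivations are
-- well-founded (possibly infinitely branching) trees, i.e. transfinite
-- derivations; the rules MP, Nec and □Inf apply to anything derived.

infix 3 _⊢_

data _⊢_ (Γ : Fm → Set) : Fm → Set where
  hyp  : ∀ {φ} → Γ φ → Γ ⊢ φ
  ax   : ∀ {φ} → Axiom φ → Γ ⊢ φ
  mp   : ∀ {φ ψ} → Γ ⊢ φ → Γ ⊢ (φ ⇒ ψ) → Γ ⊢ ψ
  nec  : ∀ {φ} → Γ ⊢ φ → Γ ⊢ □ φ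
  □inf : ∀ {φ α β} →
         ((n : ℕ) → Γ ⊢ (□ φ ∨ (□ α ⇒ (□ β ^ n)))) →
         Γ ⊢ (□ φ ∨ (□ α ⇒ (□ α & □ β)))

IsTheory : (Fm → Set) → Set
IsTheory Γ = ∀ φ → Γ ⊢ φ → Γ φ

□-Prelinear : (Fm → Set) → Set
□-Prelinear Γ = ∀ α β → Γ (□ α ⇒ □ β) ⊎ Γ (□ β ⇒ □ α)

record MMVSig : Set₁ where
  field
    Carrier : Set
    _≈_ : Carrier → Carrier → Set
    _⊓_ _⊔_ _⊙_ _↣_ : Carrier → Carrier → Carrier
    0# 1# : Carrier
    all ex : Carrier → Carrier

-- MV-algebras, presented as BL-algebras satisfying double negation
-- (x ≤ y means x ⊓ y ≈ x)
record IsMonadicMV (A : MMVSig) : Set where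
  open MMVSig A
  _≤_ : Carrier → Carrier → Set
  x ≤ y = (x ⊓ y) ≈ x
  field
    isEquivalence : IsEquivalence _≈_
    ⊓-cong : ∀ {x y u v} → x ≈ y → u ≈ v → (x ⊓ u) ≈ (y ⊓ v)
    ⊔-cong : ∀ {x y u v} → x ≈ y → u ≈ v → (x ⊔ u) ≈ (y ⊔ v)
    ⊙-cong : ∀ {x y u v} → x ≈ y → u ≈ v → (x ⊙ u) ≈ (y ⊙ v)
    ↣-cong : ∀ {x y u v} → x ≈ y → u ≈ v → (x ↣ u) ≈ (y ↣ v)
    all-cong : ∀ {x y} → x ≈ y → all x ≈ all y
    ex-cong  : ∀ {x y} → x ≈ y → ex x ≈ ex y
    ⊓-assoc : ∀ x y z → ((x ⊓ y) ⊓ z) ≈ (x ⊓ (y ⊓ z))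
    ⊔-assoc : ∀ x y z → ((x ⊔ y) ⊔ z) ≈ (x ⊔ (y ⊔ z))
    ⊓-comm : ∀ x y → (x ⊓ y) ≈ (y ⊓ x)
    ⊔-comm : ∀ x y → (x ⊔ y) ≈ (y ⊔ x)
    ⊓-absorbs-⊔ : ∀ x y → (x ⊓ (x ⊔ y)) ≈ x
    ⊔-absorbs-⊓ : ∀ x y → (x ⊔ (x ⊓ y)) ≈ x
    0-least : ∀ x → (0# ⊓ x) ≈ 0#
    1-greatest : ∀ x → (x ⊓ 1#) ≈ x
    ⊙-assoc : ∀ x y z → ((x ⊙ y) ⊙ z) ≈ (x ⊙ (y ⊙ z))
    ⊙-comm : ∀ x y → (x ⊙ y) ≈ (y ⊙ x)
    ⊙-identity : ∀ x → (x ⊙ 1#) ≈ x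
    residuation₁ : ∀ x y z → (x ⊙ y) ≤ z → x ≤ (y ↣ z)
    residuation₂ : ∀ x y z → x ≤ (y ↣ z) → (x ⊙ y) ≤ z
    divisibility : ∀ x y → (x ⊓ y) ≈ (x ⊙ (x ↣ y))
    prelinearity : ∀ x y → ((x ↣ y) ⊔ (y ↣ x)) ≈ 1#
    involution : ∀ x → ((x ↣ 0#) ↣ 0#) ≈ x
    M-1 : ∀ x → (all x ↣ x) ≈ 1#
    M-2 : ∀ x y → all (x ↣ all y) ≈ (ex x ↣ all y)
    M-3 : ∀ x y → all (all x ↣ y) ≈ (all x ↣ all y)
    M-4 : ∀ x y → all (ex x ⊔ y) ≈ (ex x ⊔ all y)
    M-5 : ∀ x → ex (x ⊙ x) ≈ (ex x ⊙ ex x)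

record IsCongruence (A : MMVSig) (θ : MMVSig.Carrier A → MMVSig.Carrier A → Set) : Set where
  open MMVSig A
  field
    isEquivalence : IsEquivalence θ
    ≈⊆θ : ∀ {x y} → x ≈ y → θ x y
    ⊓-cong : ∀ {x y u v} → θ x y → θ u v → θ (x ⊓ u) (y ⊓ v)
    ⊔-cong : ∀ {x y u v} → θ x y → θ u v → θ (x ⊔ u) (y ⊔ v)
    ⊙-cong : ∀ {x y u v} → θ x y → θ u v → θ (x ⊙ u) (y ⊙ v)
    ↣-cong : ∀ {x y u v} → θ x y → θ u v → θ (x ↣ u) (y ↣ v)
    all-cong : ∀ {x y} → θ x y → θ (all x) (all y)
    ex-cong  : ∀ {x y} → θ x y → θ (ex x) (ex y)

IsSimple : MMVSig → Set₁
IsSimple A =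
  (Σ Carrier λ x → Σ Carrier λ y → ¬ (x ≈ y)) ×
  (∀ θ → IsCongruence A θ →
     (∀ x y → θ x y → x ≈ y) ⊎ (∀ x y → θ x y))
  where open MMVSig A

-- Lindenbaum algebra L_Γ (quotient represented as the setoid (Fm, ≡_Γ))

_≡[_]_ : Fm → (Fm → Set) → Fm → Set
φ ≡[ Γ ] ψ = (Γ ⊢ (φ ⇒ ψ)) × (Γ ⊢ (ψ ⇒ φ))

Lindenbaum : (Fm → Set) → MMVSig
Lindenbaum Γ = record
  { Carrier = Fm
  ; _≈_ = λ φ ψ → φ ≡[ Γ ] ψ
  ; _⊓_ = _∧_
  ; _⊔_ = _∨_
  ; _⊙_ = _&_
  ; _↣_ = _⇒_
  ; 0# = 𝟘
  ; 1# = 𝟙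
  ; all = □
  ; ex = ◇
  }

{-# OPTIONS --safe #-}

-- The monadic MV-algebra identities hold in L_Γ because each is an axiom of
-- S5(Ł) or follows from one by necessitation and the ν-axioms, which make
-- ν ≤ □ν for every ν.
--
-- For simplicity, let θ be a congruence and x θ y; then b = □(x ≡ y) θ 1.
-- If some such b is nilpotent (b^n ≤ 0) then 0 θ 1 and θ is total.
-- Otherwise □-prelinearity compares □¬b with every □(b^n): the comparison
-- □(b^n) ≤ □¬b would give b^(n+1) ≤ 0, so □¬b ≤ □(b^n) ≤ b^n for all n.
-- Now □Inf yields □¬b ≤ □¬b * b ≤ 0, hence ¬b ≤ □¬b ≤ 0, so b, and with it
-- x ≡ y, is derivable: θ is the identity.

module Submission where

open import Defs
open import Level using (0ℓ)
open import Data.Nat using (zero; suc)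
open import Data.Product using (_×_; ∃; _,_; proj₁; proj₂)
open import Data.Sum using (_⊎_; inj₁; inj₂)
open import Data.Empty using (⊥-elim)
open import Relation.Nullary using (¬_; yes; no)
open import Relation.Binary.Structures using (IsEquivalence)
open import Relation.Binary.Bundles using (Preorder)
import Relation.Binary.Reasoning.Preorder as PreorderReasoning
open import Axiom.ExcludedMiddle using (ExcludedMiddle)

IsNu-^ : ∀ {ψ} n → IsNu ψ → IsNu (ψ ^ n)
IsNu-^ zero    _ = nu⇒ nu𝟘 nu𝟘
IsNu-^ (suc n) ν = nu& (IsNu-^ n ν) ν

module Derivability (Γ : Fm → Set) where

  infix 3 _≤_ _≈_

  _≤_ : Fm → Fm → Set
  a ≤ b = Γ ⊢ a ⇒ b

  _≈_ : Fm → Fm → Set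
  a ≈ b = a ≡[ Γ ] b

  Nilpotent : Fm → Set
  Nilpotent a = ∃ λ n → a ^ n ≤ 𝟘

  ≤-trans : ∀ {a b c} → a ≤ b → b ≤ c → a ≤ c
  ≤-trans {a} {b} {c} p q = mp q (mp p (ax (L1 a b c)))

  ⊢𝟙 : Γ ⊢ 𝟙
  ⊢𝟙 = ax (L9 𝟘)

  curry : ∀ {a b c} → a & b ≤ c → a ≤ b ⇒ c
  curry {a} {b} {c} p = mp p (ax (L7b a b c))

  uncurry : ∀ {a b c} → a ≤ b ⇒ c → a & b ≤ c
  uncurry {a} {b} {c} p = mp p (ax (L7a a b c))

  &-comm : ∀ {a b} → a & b ≤ b & a
  &-comm {a} {b} = ax (L3 a b)

  &-elimˡ : ∀ {a b} → a & b ≤ a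
  &-elimˡ {a} {b} = ax (L2 a b)

  &-elimʳ : ∀ {a b} → a & b ≤ b
  &-elimʳ {a} {b} = ≤-trans &-comm (ax (L2 b a))

  ≤-refl : ∀ {a} → a ≤ a
  ≤-refl {a} = mp ⊢𝟙 (curry (&-elimʳ {𝟙} {a}))

  ≈-isEquivalence : IsEquivalence _≈_
  ≈-isEquivalence = record
    { refl  = ≤-refl , ≤-refl
    ; sym   = λ (p , q) → q , p
    ; trans = λ (p , q) (r , s) → ≤-trans p r , ≤-trans s q
    }

  ≤-preorder : Preorder 0ℓ 0ℓ 0ℓ
  ≤-preorder = record
    { Carrier    = Fm
    ; _≈_        = _≈_
    ; _≲_        = _≤_
    ; isPreorder = record
      { isEquivalence = ≈-isEquivalence
      ; reflexive     = proj₁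
      ; trans         = ≤-trans
      }
    }

  open PreorderReasoning ≤-preorder using (begin_; step-≲; _∎)

  ⊢⇒≤ : ∀ {a b} → Γ ⊢ b → a ≤ b
  ⊢⇒≤ p = mp p (curry &-elimˡ)

  𝟘≤ : ∀ {a} → 𝟘 ≤ a
  𝟘≤ {a} = ax (L9 a)

  ≤𝟙 : ∀ {a} → a ≤ 𝟙
  ≤𝟙 = ⊢⇒≤ ⊢𝟙

  ⊢⇒≈𝟙 : ∀ {a} → Γ ⊢ a → a ≈ 𝟙
  ⊢⇒≈𝟙 p = ≤𝟙 , ⊢⇒≤ p

  eval : ∀ {a b} → (a ⇒ b) & a ≤ b
  eval = uncurry ≤-refl

  ≤-⇒⇒ : ∀ {a b} → a ≤ (a ⇒ b) ⇒ b
  ≤-⇒⇒ = curry (≤-trans &-comm eval)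

  ⊢⇒≤&ʳ : ∀ {a b} → Γ ⊢ b → a ≤ a & b
  ⊢⇒≤&ʳ p = ≤-trans (curry ≤-refl) (mp p ≤-⇒⇒)

  &-monoˡ : ∀ {a b c} → a ≤ b → a & c ≤ b & c
  &-monoˡ p = uncurry (≤-trans p (curry ≤-refl))

  &-monoʳ : ∀ {a b c} → a ≤ b → c & a ≤ c & b
  &-monoʳ p = ≤-trans &-comm (≤-trans (&-monoˡ p) &-comm)

  &-mono : ∀ {a b c d} → a ≤ b → c ≤ d → a & c ≤ b & d
  &-mono p q = ≤-trans (&-monoˡ p) (&-monoʳ q)

  ⇒-monoʳ : ∀ {a b c} → b ≤ c → a ⇒ b ≤ a ⇒ c
  ⇒-monoʳ p = curry (≤-trans eval p)

  ⇒-antiˡ : ∀ {a b c} → a ≤ b → b ⇒ c ≤ a ⇒ c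
  ⇒-antiˡ p = curry (≤-trans (&-monoʳ p) eval)

  ⇒-mono : ∀ {a b c d} → b ≤ a → c ≤ d → a ⇒ c ≤ b ⇒ d
  ⇒-mono p q = ≤-trans (⇒-monoʳ q) (⇒-antiˡ p)

  &-assocʳ : ∀ {a b c} → (a & b) & c ≤ a & (b & c)
  &-assocʳ {a} {b} {c} = uncurry (uncurry (≤-trans (curry ≤-refl) (ax (L7b b c (a & (b & c))))))

  &-assoc : ∀ {a b c} → (a & b) & c ≈ a & (b & c)
  &-assoc {a} {b} {c} = &-assocʳ , (begin
    a & (b & c)  ≲⟨ &-comm ⟩
    (b & c) & a  ≲⟨ &-monoˡ &-comm ⟩
    (c & b) & a  ≲⟨ &-assocʳ ⟩
    c & (b & a)  ≲⟨ &-monoʳ &-comm ⟩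
    c & (a & b)  ≲⟨ &-comm ⟩
    (a & b) & c  ∎)

  &-identityʳ : ∀ {a} → a & 𝟙 ≈ a
  &-identityʳ = &-elimˡ , ⊢⇒≤&ʳ ⊢𝟙

  ∧-elimˡ : ∀ {a b} → a ∧ b ≤ a
  ∧-elimˡ {a} {b} = ax (L4 a b)

  ∧-comm : ∀ {a b} → a ∧ b ≤ b ∧ a
  ∧-comm {a} {b} = ax (L5 a b)

  ∧-elimʳ : ∀ {a b} → a ∧ b ≤ b
  ∧-elimʳ = ≤-trans ∧-comm ∧-elimˡ

  ∧-intro : ∀ {a b c} → c ≤ a → c ≤ b → c ≤ a ∧ b
  ∧-intro {a} {b} {c} c≤a c≤b = begin
    c            ≲⟨ ⊢⇒≤&ʳ c≤a ⟩
    c & (c ⇒ a)  ≲⟨ ax (L6a c a) ⟩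
    c ∧ a        ≲⟨ ∧-comm ⟩
    a ∧ c        ≲⟨ ax (L6b a c) ⟩
    a & (a ⇒ c)  ≲⟨ &-monoʳ (⇒-monoʳ c≤b) ⟩
    a & (a ⇒ b)  ≲⟨ ax (L6a a b) ⟩
    a ∧ b        ∎

  ∧-mono : ∀ {a b c d} → a ≤ b → c ≤ d → a ∧ c ≤ b ∧ d
  ∧-mono p q = ∧-intro (≤-trans ∧-elimˡ p) (≤-trans ∧-elimʳ q)

  ∨-introˡ : ∀ {a b} → a ≤ a ∨ b
  ∨-introˡ {a} {b} = ax (L10 a b)

  ∨-introʳ : ∀ {a b} → b ≤ a ∨ b
  ∨-introʳ {a} {b} = ax (L11 a b)

  ∨-elim : ∀ {a b c} → a ≤ c → b ≤ c → a ∨ b ≤ c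
  ∨-elim {a} {b} {c} p q = mp q (mp p (ax (L12 a b c)))

  ∨-comm : ∀ {a b} → a ∨ b ≤ b ∨ a
  ∨-comm = ∨-elim ∨-introʳ ∨-introˡ

  ∨-mono : ∀ {a b c d} → a ≤ b → c ≤ d → a ∨ c ≤ b ∨ d
  ∨-mono p q = ∨-elim (≤-trans p ∨-introˡ) (≤-trans q ∨-introʳ)

  ≤⇒∧≈ : ∀ {a b} → a ≤ b → a ∧ b ≈ a
  ≤⇒∧≈ p = ∧-elimˡ , ∧-intro ≤-refl p

  ∧≈⇒≤ : ∀ {a b} → a ∧ b ≈ a → a ≤ b
  ∧≈⇒≤ e = ≤-trans (proj₂ e) ∧-elimʳ

  ⊢& : ∀ {a b} → Γ ⊢ a → Γ ⊢ b → Γ ⊢ a & b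
  ⊢& pa pb = mp pb (mp pa (curry ≤-refl))

  ⊢𝟙^ : ∀ n → Γ ⊢ 𝟙 ^ n
  ⊢𝟙^ zero    = ⊢𝟙
  ⊢𝟙^ (suc n) = ⊢& (⊢𝟙^ n) ⊢𝟙

  ⊢≣⇒≈ : ∀ {a b} → Γ ⊢ a ≣ b → a ≈ b
  ⊢≣⇒≈ p = mp p ∧-elimˡ , mp p ∧-elimʳ

  □-elim : ∀ {a} → □ a ≤ a
  □-elim {a} = ax (M1 a)

  IsNu⇒≤□ : ∀ {ν} → IsNu ν → ν ≤ □ ν
  IsNu⇒≤□ {ν} n = mp (nec ≤-refl) (ax (M3 ν ν n))

  □-mono : ∀ {a b} → a ≤ b → □ a ≤ □ b
  □-mono {a} {b} p = mp (nec (≤-trans □-elim p)) (ax (M3 (□ a) b (nu□ a)))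

  ◇-mono : ∀ {a b} → a ≤ b → ◇ a ≤ ◇ b
  ◇-mono {a} {b} p = mp (nec (≤-trans p (ax (M2 b)))) (ax (M4 (◇ b) a (nu◇ b)))

  □-derivable-unless-nilpotent : □-Prelinear Γ → ∀ {β} → ¬ Nilpotent (□ β) → Γ ⊢ □ β
  □-derivable-unless-nilpotent prelinear {β} b-not-nilpotent =
    mp (≤-trans (IsNu⇒≤□ (nu⇒ (nu□ β) nu𝟘)) □¬b≤𝟘) (ax (L13 b))
    where
    b ¬b : Fm
    b  = □ β
    ¬b = b ⇒ 𝟘

    □¬b≤b^ : ∀ n → □ ¬b ≤ b ^ n
    □¬b≤b^ n with prelinear ¬b (b ^ n)
    ... | inj₁ □¬b≤□b^n = ≤-trans (hyp □¬b≤□b^n) □-elim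
    ... | inj₂ □b^n≤□¬b = ⊥-elim (b-not-nilpotent (suc n , uncurry (begin
      b ^ n      ≲⟨ IsNu⇒≤□ (IsNu-^ n (nu□ β)) ⟩
      □ (b ^ n)  ≲⟨ hyp □b^n≤□¬b ⟩
      □ ¬b       ≲⟨ □-elim ⟩
      ¬b         ∎)))

    □¬b≤𝟘 : □ ¬b ≤ 𝟘
    □¬b≤𝟘 = mp (□inf (λ n → mp (□¬b≤b^ n) ∨-introʳ))
               (∨-elim (≤-trans □-elim 𝟘≤) (⇒-monoʳ (≤-trans (&-monoˡ □-elim) eval)))

  lindenbaum-isMonadicMV : IsMonadicMV (Lindenbaum Γ)
  lindenbaum-isMonadicMV = record
    { isEquivalence = ≈-isEquivalence
    ; ⊓-cong        = λ (p , q) (r , s) → ∧-mono p r , ∧-mono q s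
    ; ⊔-cong        = λ (p , q) (r , s) → ∨-mono p r , ∨-mono q s
    ; ⊙-cong        = λ (p , q) (r , s) → &-mono p r , &-mono q s
    ; ↣-cong        = λ (p , q) (r , s) → ⇒-mono q r , ⇒-mono p s
    ; all-cong      = λ (p , q) → □-mono p , □-mono q
    ; ex-cong       = λ (p , q) → ◇-mono p , ◇-mono q
    ; ⊓-assoc       = λ _ _ _ → ∧-intro (≤-trans ∧-elimˡ ∧-elimˡ) (∧-mono ∧-elimʳ ≤-refl)
                              , ∧-intro (∧-mono ≤-refl ∧-elimˡ) (≤-trans ∧-elimʳ ∧-elimʳ)
    ; ⊔-assoc       = λ _ _ _ → ∨-elim (∨-mono ≤-refl ∨-introˡ) (≤-trans ∨-introʳ ∨-introʳ)
                              , ∨-elim (≤-trans ∨-introˡ ∨-introˡ) (∨-mono ∨-introʳ ≤-refl)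
    ; ⊓-comm        = λ _ _ → ∧-comm , ∧-comm
    ; ⊔-comm        = λ _ _ → ∨-comm , ∨-comm
    ; ⊓-absorbs-⊔   = λ _ _ → ≤⇒∧≈ ∨-introˡ
    ; ⊔-absorbs-⊓   = λ _ _ → ∨-elim ≤-refl ∧-elimˡ , ∨-introˡ
    ; 0-least       = λ _ → ≤⇒∧≈ 𝟘≤
    ; 1-greatest    = λ _ → ≤⇒∧≈ ≤𝟙
    ; ⊙-assoc       = λ _ _ _ → &-assoc
    ; ⊙-comm        = λ _ _ → &-comm , &-comm
    ; ⊙-identity    = λ _ → &-identityʳ
    ; residuation₁  = λ _ _ _ h → ≤⇒∧≈ (curry (∧≈⇒≤ h))
    ; residuation₂  = λ _ _ _ h → ≤⇒∧≈ (uncurry (∧≈⇒≤ h))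
    ; divisibility  = λ x y → ax (L6b x y) , ax (L6a x y)
    ; prelinearity  = λ x y → ⊢⇒≈𝟙 (mp ∨-introʳ (mp ∨-introˡ (ax (L8 x y _))))
    ; involution    = λ x → ax (L13 x) , ≤-⇒⇒
    ; M-1           = λ x → ⊢⇒≈𝟙 (ax (M1 x))
    ; M-2           = λ x y → ax (M4 (□ y) x (nu□ y))
                            , ≤-trans (IsNu⇒≤□ (nu⇒ (nu◇ x) (nu□ y))) (□-mono (⇒-antiˡ (ax (M2 x))))
    ; M-3           = λ x y → ax (M3 (□ x) y (nu□ x))
                            , ≤-trans (IsNu⇒≤□ (nu⇒ (nu□ x) (nu□ y))) (□-mono (⇒-monoʳ □-elim))
    ; M-4           = λ x y → ≤-trans (□-mono ∨-comm) (≤-trans (ax (M5 (◇ x) y (nu◇ x))) ∨-comm)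
                            , ∨-elim (≤-trans (IsNu⇒≤□ (nu◇ x)) (□-mono ∨-introˡ)) (□-mono ∨-introʳ)
    ; M-5           = λ x → ⊢≣⇒≈ (ax (M6 x))
    }

module LindenbaumCongruence (Γ : Fm → Set) (θ : Fm → Fm → Set)
                            (θ-congruence : IsCongruence (Lindenbaum Γ) θ) where

  open Derivability Γ
  open IsCongruence θ-congruence
  open IsEquivalence isEquivalence renaming (refl to θ-refl; sym to θ-sym; trans to θ-trans)

  θ-^ : ∀ {a b} n → θ a b → θ (a ^ n) (b ^ n)
  θ-^ zero    _ = θ-refl
  θ-^ (suc n) h = ⊙-cong (θ-^ n h) h

  θ⇒θ-□≣𝟙 : ∀ {x y} → θ x y → θ (□ (x ≣ y)) 𝟙
  θ⇒θ-□≣𝟙 {x} {y} h = θ-trans (all-cong (θ-trans x≣y-θ-y≣y (≈⊆θ (⊢⇒≈𝟙 ⊢y≣y))))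
                               (≈⊆θ (⊢⇒≈𝟙 (nec ⊢𝟙)))
    where
    x≣y-θ-y≣y : θ (x ≣ y) (y ≣ y)
    x≣y-θ-y≣y = ⊓-cong (↣-cong h θ-refl) (↣-cong θ-refl h)
    ⊢y≣y : Γ ⊢ y ≣ y
    ⊢y≣y = mp ⊢𝟙 (∧-intro (⊢⇒≤ ≤-refl) (⊢⇒≤ ≤-refl))

  θ-𝟘𝟙⇒total : θ 𝟘 𝟙 → ∀ u v → θ u v
  θ-𝟘𝟙⇒total θ-𝟘𝟙 u v = θ-trans (θ-𝟘 u) (θ-sym (θ-𝟘 v))
    where
    θ-𝟘 : ∀ w → θ w 𝟘
    θ-𝟘 w = θ-trans (≈⊆θ (∧-intro ≤-refl ≤𝟙 , ∧-elimˡ))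
              (θ-trans (⊓-cong θ-refl (θ-sym θ-𝟘𝟙)) (≈⊆θ (∧-elimʳ , 𝟘≤)))

  θ-𝟙-nilpotent⇒total : ∀ {a} → θ a 𝟙 → Nilpotent a → ∀ u v → θ u v
  θ-𝟙-nilpotent⇒total h (n , a^n≤𝟘) = θ-𝟘𝟙⇒total
    (θ-trans (≈⊆θ (𝟘≤ , a^n≤𝟘)) (θ-trans (θ-^ n h) (≈⊆θ (⊢⇒≈𝟙 (⊢𝟙^ n)))))

module _ (Γ : Fm → Set) where

  open Derivability Γ

  lindenbaum-isSimple : ExcludedMiddle 0ℓ → □-Prelinear Γ → ¬ (Γ ⊢ 𝟘) → IsSimple (Lindenbaum Γ)
  lindenbaum-isSimple lem prelinear consistent = (𝟘 , 𝟙 , λ (_ , 𝟙≤𝟘) → consistent (mp ⊢𝟙 𝟙≤𝟘)) , trivial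
    where
    trivial : ∀ θ → IsCongruence (Lindenbaum Γ) θ → (∀ x y → θ x y → x ≈ y) ⊎ (∀ x y → θ x y)
    trivial θ θ-congruence with lem {∃ λ x → ∃ λ y → θ x y × Nilpotent (□ (x ≣ y))}
    ... | yes (_ , _ , h , nilpotent) = inj₂ (θ-𝟙-nilpotent⇒total (θ⇒θ-□≣𝟙 h) nilpotent)
      where open LindenbaumCongruence Γ θ θ-congruence
    ... | no none = inj₁ λ x y h →
      ⊢≣⇒≈ (mp (□-derivable-unless-nilpotent prelinear λ nilpotent → none (x , y , h , nilpotent)) □-elim)

mainTheorem16 : ExcludedMiddle 0ℓ → (Γ : Fm → Set) → IsTheory Γ → □-Prelinear Γ → ¬ (Γ ⊢ 𝟘) →
    IsMonadicMV (Lindenbaum Γ) × IsSimple (Lindenbaum Γ)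
mainTheorem16 lem Γ _ prelinear consistent =
  Derivability.lindenbaum-isMonadicMV Γ , lindenbaum-isSimple Γ lem prelinear consistent
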